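{- Let $s\ge 2$ and $\rho\ge 2$ be integers and let $r=\rho s$. Let $G=(V_1\cup V_2,E)$ be a bipartite biregular graph of diameter $3$ in which every vertex of $V_1$ has degree $r$ and every vertex of $V_2$ has degree $s$, and let $N_1=|V_1|$, $N_2=|V_2|$. (i) If $\rho$ divides $s-1$, then $N_1\le (s^2-1)-\frac{s-1}{\rho}$ and $N_2\le \rho(s^2-1)-(s-1)$. (ii) If $\rho$ does not divide $s-1$, then $N_1\le s^2-\lceil s/\rho\rceil$ and $N_2\le \rho\,(s^2-\lceil s/\rho\rceil)$.
   Context: A bipartite graph with stable sets $V_1,V_2$ is biregular with degrees $r,s$ if all vertices of $V_1$ have degree $r$ and all vertices of $V_2$ have degree $s$. -}

module Defs where

open import Data.Nat using (ℕ; zero; suc; _+_; _*_; _∸_; _≤_; _/_)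
open import Data.Bool using (Bool; true; false; T)
open import Data.Fin using (Fin)
open import Data.List using (List; length; filterᵇ)
open import Data.List using () renaming ([] to nil)
open import Data.Sum using (_⊎_; inj₁; inj₂)
open import Data.Product using (Σ; _×_; ∃-syntax)
open import Data.Empty using (⊥)
open import Data.Unit using (⊤)
open import Data.Fin using () renaming (zero to fz)
open import Data.List using (allFin)
open import Relation.Binary.PropositionalEquality using (_≡_)
open import Relation.Nullary using (¬_)

-- A (finite, simple) bipartite graph with stable sets V₁ = Fin n₁, V₂ = Fin n₂,
-- given by its bipartite adjacency relation (edges only between V₁ and V₂).
BipAdj : ℕ → ℕ → Set
BipAdj n₁ n₂ = Fin n₁ → Fin n₂ → Bool

deg₁ : ∀ {n₁ n₂} → BipAdj n₁ n₂ → Fin n₁ → ℕ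
deg₁ {n₂ = n₂} A u = length (filterᵇ (A u) (allFin n₂))

deg₂ : ∀ {n₁ n₂} → BipAdj n₁ n₂ → Fin n₂ → ℕ
deg₂ {n₁ = n₁} A v = length (filterᵇ (λ u → A u v) (allFin n₁))

Biregular : ∀ {n₁ n₂} → BipAdj n₁ n₂ → ℕ → ℕ → Set
Biregular A r s = (∀ u → deg₁ A u ≡ r) × (∀ v → deg₂ A v ≡ s)

Vtx : ℕ → ℕ → Set
Vtx n₁ n₂ = Fin n₁ ⊎ Fin n₂

Adj : ∀ {n₁ n₂} → BipAdj n₁ n₂ → Vtx n₁ n₂ → Vtx n₁ n₂ → Set
Adj A (inj₁ u) (inj₂ v) = T (A u v)
Adj A (inj₂ v) (inj₁ u) = T (A u v)
Adj A (inj₁ _) (inj₁ _) = ⊥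
Adj A (inj₂ _) (inj₂ _) = ⊥

Walk : ∀ {n₁ n₂} → BipAdj n₁ n₂ → ℕ → Vtx n₁ n₂ → Vtx n₁ n₂ → Set
Walk A zero x y = x ≡ y
Walk A (suc k) x y = Σ _ (λ z → Adj A x z × Walk A k z y)

DistLe : ∀ {n₁ n₂} → BipAdj n₁ n₂ → ℕ → Vtx n₁ n₂ → Vtx n₁ n₂ → Set
DistLe A d x y = ∃[ k ] (k ≤ d × Walk A k x y)

Diameter : ∀ {n₁ n₂} → BipAdj n₁ n₂ → ℕ → Set
Diameter A d = (∀ x y → DistLe A d x y)
             × (∃[ x ] ∃[ y ] ¬ DistLe A (d ∸ 1) x y)

-- ceiling division ⌈ a / b ⌉ (for b ≥ 1; we set ⌈ a / 0 ⌉ = 0, never used)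
⌈_/_⌉ : ℕ → ℕ → ℕ
⌈ a / zero ⌉ = zero
⌈ a / suc b ⌉ = (a + b) / suc b

nz : ∀ {ρ} → 2 ≤ ρ → Data.Nat.NonZero ρ
nz (Data.Nat.s≤s _) = _

-- For v ∈ V₂, counting paths v – u – w gives ∑_w codeg(v, w) = rs, and diameter 3 forces
-- codeg(v, w) ≥ 1 for w ≠ v, whence the Moore-type bound s + N₂ − 1 ≤ rs.  Equality would make
-- all codegrees in V₂ at most 1, so G would have no 4-cycle, and then counting from a vertex of
-- V₁ gives rs ≤ r + N₁ − 1, which contradicts N₁ ≤ s² as soon as ρ, s ≥ 2.  Hence the bound is
-- strict; since N₂ = ρN₁, it reads (s − 1) + ρN₁ < ρs², that is N₁ + ⌈s/ρ⌉ ≤ s².  This is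
-- the bound in (i) as well as in (ii), because ⌈s/ρ⌉ = (s − 1)/ρ + 1 when ρ ∣ s − 1.
module Submission where

open import Defs
open import Data.Bool using (Bool; true; false; T; _∧_)
open import Data.Bool.Properties using (T-≡; T-∧; ∧-idem)
open import Data.Empty using (⊥-elim)
open import Data.Fin using (Fin; zero; suc; punchIn; punchOut)
open import Data.Fin.Properties using (punchInᵢ≢i; punchIn-punchOut) renaming (suc-injective to Fin-suc-injective)
open import Data.List using (length; filterᵇ; tabulate)
open import Data.Nat using (ℕ; zero; suc; _+_; _*_; _∸_; _≤_; _<_; _/_; z≤n; s≤s; s≤s⁻¹; NonZero)
open import Data.Nat.Divisibility using (_∣_; ∣-refl)
open import Data.Nat.DivMod using (+-distrib-/-∣ʳ; n/n≡1; m/n*n≤m; m/n≤m; m*[n/m]≡n)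
open import Data.Nat.Properties
open import Algebra.Properties.Semiring.Sum +-*-semiring
open import Data.Nat.Solver using (module +-*-Solver)
open import Data.Product using (_×_; _,_; ∃-syntax; proj₁; proj₂; swap)
open import Data.Sum using (_⊎_; inj₁; inj₂)
open import Data.Vec.Functional using (Vector)
open import Function using (_∘_; Equivalence)
open import Relation.Binary.PropositionalEquality
open import Relation.Nullary using (¬_)

open Equivalence using (to; from)

sum-const : ∀ n k → ∑[ i < n ] k ≡ n * k
sum-const zero    k = refl
sum-const (suc n) k = cong (k +_) (sum-const n k)

sum-ones : ∀ n → ∑[ i < n ] 1 ≡ n
sum-ones n = trans (sum-const n 1) (*-identityʳ n)

sum-mono-≤ : ∀ {n} {f g : Vector ℕ n} → (∀ i → f i ≤ g i) → sum f ≤ sum g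
sum-mono-≤ {zero}  f≤g = z≤n
sum-mono-≤ {suc n} f≤g = +-mono-≤ (f≤g zero) (sum-mono-≤ (f≤g ∘ suc))

sum-mono-< : ∀ {n} {f g : Vector ℕ n} → (∀ i → f i ≤ g i) → ∀ j → f j < g j → sum f < sum g
sum-mono-< f≤g zero    fj<gj = +-mono-<-≤ fj<gj (sum-mono-≤ (f≤g ∘ suc))
sum-mono-< f≤g (suc j) fj<gj = +-mono-≤-< (f≤g zero) (sum-mono-< (f≤g ∘ suc) j fj<gj)

term≤sum : ∀ {n} (f : Vector ℕ n) i → f i ≤ sum f
term≤sum f zero    = m≤m+n (f zero) _
term≤sum f (suc i) = ≤-trans (term≤sum (f ∘ suc) i) (m≤n+m _ (f zero))

module _ {n} (t : Vector ℕ (suc n)) (i : Fin (suc n)) where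

  private
    sum-split : sum t ≡ t i + ∑[ j < n ] t (punchIn i j)
    sum-split = sum-remove t

  sum-≥-off-diagonal : (∀ j → j ≢ i → 1 ≤ t j) → t i + n ≤ sum t
  sum-≥-off-diagonal 1≤t = begin
    t i + n                          ≡⟨ cong (t i +_) (sum-ones n) ⟨
    t i + ∑[ j < n ] 1               ≤⟨ +-monoʳ-≤ (t i) (sum-mono-≤ (λ j → 1≤t _ (punchInᵢ≢i i j))) ⟩
    t i + ∑[ j < n ] t (punchIn i j) ≡⟨ sum-split ⟨
    sum t                            ∎
    where open ≤-Reasoning

  sum-≤-off-diagonal : (∀ j → j ≢ i → t j ≤ 1) → sum t ≤ t i + n
  sum-≤-off-diagonal t≤1 = begin
    sum t                            ≡⟨ sum-split ⟩
    t i + ∑[ j < n ] t (punchIn i j) ≤⟨ +-monoʳ-≤ (t i) (sum-mono-≤ (λ j → t≤1 _ (punchInᵢ≢i i j))) ⟩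
    t i + ∑[ j < n ] 1               ≡⟨ cong (t i +_) (sum-ones n) ⟩
    t i + n                          ∎
    where open ≤-Reasoning

  off-diagonal-tight : (∀ j → j ≢ i → 1 ≤ t j) → sum t ≡ t i + n → ∀ j → j ≢ i → t j ≤ 1
  off-diagonal-tight 1≤t tight j j≢i =
    ≮⇒≥ λ 1<tj → <-irrefl (sym off-sum) (off-sum-exceeds (subst (λ k → 1 < t k) (sym (punchIn-punchOut i≢j)) 1<tj))
    where
    i≢j = j≢i ∘ sym
    off-sum : ∑[ j < n ] t (punchIn i j) ≡ n
    off-sum = +-cancelˡ-≡ (t i) _ _ (trans (sym sum-split) tight)
    off-sum-exceeds : 1 < t (punchIn i (punchOut i≢j)) → n < ∑[ j < n ] t (punchIn i j)
    off-sum-exceeds 1<tj = begin-strict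
      n                          ≡⟨ sum-ones n ⟨
      ∑[ j < n ] 1               <⟨ sum-mono-< (λ j → 1≤t _ (punchInᵢ≢i i j)) (punchOut i≢j) 1<tj ⟩
      ∑[ j < n ] t (punchIn i j) ∎
      where open ≤-Reasoning

indicator : Bool → ℕ
indicator true  = 1
indicator false = 0

indicator-∧ : ∀ x y → indicator (x ∧ y) ≡ indicator x * indicator y
indicator-∧ true  y = sym (+-identityʳ (indicator y))
indicator-∧ false y = refl

T⇒1≤indicator : ∀ {x} → T x → 1 ≤ indicator x
T⇒1≤indicator {true} _ = s≤s z≤n

length-filterᵇ-tabulate : ∀ {A : Set} (p : A → Bool) n (f : Fin n → A) →
                          length (filterᵇ p (tabulate f)) ≡ ∑[ i < n ] indicator (p (f i))
length-filterᵇ-tabulate p zero    f = refl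
length-filterᵇ-tabulate p (suc n) f with p (f zero)
... | true  = cong suc (length-filterᵇ-tabulate p n (f ∘ suc))
... | false = length-filterᵇ-tabulate p n (f ∘ suc)

T⇒1≤count : ∀ {n} (p : Fin n → Bool) {i} → T (p i) → 1 ≤ ∑[ i < n ] indicator (p i)
T⇒1≤count p {i} pi = ≤-trans (T⇒1≤indicator pi) (term≤sum (indicator ∘ p) i)

T-pair⇒2≤count : ∀ {n} (p : Fin n → Bool) {i j} → i ≢ j → T (p i) → T (p j) → 2 ≤ ∑[ i < n ] indicator (p i)
T-pair⇒2≤count p {zero}  {zero}  i≢j _  _  = ⊥-elim (i≢j refl)
T-pair⇒2≤count p {zero}  {suc j} _   pi pj = +-mono-≤ (T⇒1≤indicator pi) (T⇒1≤count (p ∘ suc) pj)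
T-pair⇒2≤count p {suc i} {zero}  _   pi pj = +-mono-≤ (T⇒1≤indicator pj) (T⇒1≤count (p ∘ suc) pi)
T-pair⇒2≤count p {suc i} {suc j} i≢j pi pj =
  ≤-trans (T-pair⇒2≤count (p ∘ suc) (i≢j ∘ cong suc) pi pj) (m≤n+m _ (indicator (p zero)))

1≤count⇒T : ∀ {n} (p : Fin n → Bool) → 1 ≤ ∑[ i < n ] indicator (p i) → ∃[ i ] T (p i)
1≤count⇒T {suc n} p 1≤c with p zero in p0
... | true  = zero , T-≡ .from p0
... | false = let i , pi = 1≤count⇒T (p ∘ suc) 1≤c in suc i , pi

2≤count⇒T-pair : ∀ {n} (p : Fin n → Bool) → 2 ≤ ∑[ i < n ] indicator (p i) → ∃[ i ] ∃[ j ] (i ≢ j × T (p i) × T (p j))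
2≤count⇒T-pair {suc n} p 2≤c with p zero in p0
... | true  = let j , pj = 1≤count⇒T (p ∘ suc) (s≤s⁻¹ 2≤c) in zero , suc j , (λ ()) , T-≡ .from p0 , pj
... | false = let i , j , i≢j , pi , pj = 2≤count⇒T-pair (p ∘ suc) 2≤c in suc i , suc j , i≢j ∘ Fin-suc-injective , pi , pj

_ᵀ : ∀ {n m} → BipAdj n m → BipAdj m n
(B ᵀ) y x = B x y

Biregular-ᵀ : ∀ {n m} (B : BipAdj n m) {a b} → Biregular B a b → Biregular (B ᵀ) b a
Biregular-ᵀ B = swap

codeg : ∀ {n m} → BipAdj n m → Fin n → Fin n → ℕ
codeg {m = m} B x y = ∑[ z < m ] indicator (B x z ∧ B y z)

HasCommonNeighbours : ∀ {n m} → BipAdj n m → Set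
HasCommonNeighbours B = ∀ x y → x ≢ y → 1 ≤ codeg B x y

-- For bipartite graphs this says exactly that there is no 4-cycle; see C₄-free-ᵀ.
C₄-free : ∀ {n m} → BipAdj n m → Set
C₄-free B = ∀ x y → x ≢ y → codeg B x y ≤ 1

module _ {n m} (B : BipAdj n m) where

  deg₁≡count : ∀ x → deg₁ B x ≡ ∑[ z < m ] indicator (B x z)
  deg₁≡count x = length-filterᵇ-tabulate (B x) m (λ z → z)

  codeg-diagonal : ∀ x → codeg B x x ≡ deg₁ B x
  codeg-diagonal x = trans (sum-cong-≗ (λ z → cong indicator (∧-idem (B x z)))) (sym (deg₁≡count x))

module _ {n m} (B : BipAdj n m) {a b} (reg : Biregular B a b) where

  private
    deg₁≡a : ∀ x → ∑[ z < m ] indicator (B x z) ≡ a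
    deg₁≡a x = trans (sym (deg₁≡count B x)) (proj₁ reg x)

    deg₂≡b : ∀ z → ∑[ x < n ] indicator (B x z) ≡ b
    deg₂≡b z = trans (sym (deg₁≡count (B ᵀ) z)) (proj₂ reg z)

  handshake : n * a ≡ m * b
  handshake = begin
    n * a                                   ≡⟨ sum-const n a ⟨
    ∑[ x < n ] a                            ≡⟨ sum-cong-≗ deg₁≡a ⟨
    ∑[ x < n ] ∑[ z < m ] indicator (B x z) ≡⟨ ∑-comm (λ x z → indicator (B x z)) ⟩
    ∑[ z < m ] ∑[ x < n ] indicator (B x z) ≡⟨ sum-cong-≗ deg₂≡b ⟩
    ∑[ z < m ] b                            ≡⟨ sum-const m b ⟩
    m * b                                   ∎
    where open ≡-Reasoning

  sum-codeg : ∀ x → ∑[ y < n ] codeg B x y ≡ a * b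
  sum-codeg x = begin
    ∑[ y < n ] ∑[ z < m ] indicator (B x z ∧ B y z)               ≡⟨ sum-cong-≗ (λ y → sum-cong-≗ (λ z → indicator-∧ (B x z) (B y z))) ⟩
    ∑[ y < n ] ∑[ z < m ] (indicator (B x z) * indicator (B y z)) ≡⟨ ∑-comm (λ y z → indicator (B x z) * indicator (B y z)) ⟩
    ∑[ z < m ] ∑[ y < n ] (indicator (B x z) * indicator (B y z)) ≡⟨ sum-cong-≗ (λ z → *-distribˡ-sum (indicator (B x z)) (λ y → indicator (B y z))) ⟨
    ∑[ z < m ] (indicator (B x z) * ∑[ y < n ] indicator (B y z)) ≡⟨ sum-cong-≗ (λ z → cong (indicator (B x z) *_) (deg₂≡b z)) ⟩
    ∑[ z < m ] (indicator (B x z) * b)                            ≡⟨ *-distribʳ-sum b (λ z → indicator (B x z)) ⟨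
    ∑[ z < m ] indicator (B x z) * b                              ≡⟨ cong (_* b) (deg₁≡a x) ⟩
    a * b                                                         ∎
    where open ≡-Reasoning

module _ {n m} (B : BipAdj (suc n) m) {a b} (reg : Biregular B a b) where

  private
    codeg-diagonal≡a : ∀ x → codeg B x x ≡ a
    codeg-diagonal≡a x = trans (codeg-diagonal B x) (proj₁ reg x)

  moore-bound : HasCommonNeighbours B → a + n ≤ a * b
  moore-bound common = subst₂ _≤_ (cong (_+ n) (codeg-diagonal≡a zero)) (sum-codeg B reg zero)
    (sum-≥-off-diagonal (codeg B zero) zero (λ y y≢0 → common zero y (y≢0 ∘ sym)))

  moore-bound-tight⇒C₄-free : HasCommonNeighbours B → a + n ≡ a * b → C₄-free B
  moore-bound-tight⇒C₄-free common tight x y x≢y =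
    off-diagonal-tight (codeg B x) x (λ z z≢x → common x z (z≢x ∘ sym))
      (trans (sum-codeg B reg x) (trans (sym tight) (cong (_+ n) (sym (codeg-diagonal≡a x))))) y (x≢y ∘ sym)

  C₄-free-bound : C₄-free B → a * b ≤ a + n
  C₄-free-bound c4 = subst₂ _≤_ (sum-codeg B reg zero) (cong (_+ n) (codeg-diagonal≡a zero))
    (sum-≤-off-diagonal (codeg B zero) zero (λ y y≢0 → c4 zero y (y≢0 ∘ sym)))

C₄-free-ᵀ : ∀ {n m} (B : BipAdj n m) → C₄-free B → C₄-free (B ᵀ)
C₄-free-ᵀ B c4 z w z≢w = ≮⇒≥ λ 1<codeg →
  let x , y , x≢y , xzw , yzw = 2≤count⇒T-pair (λ x → B x z ∧ B x w) 1<codeg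
      xz , xw = T-∧ {B x z} .to xzw
      yz , yw = T-∧ {B y z} .to yzw
  in <⇒≱ (T-pair⇒2≤count (λ v → B x v ∧ B y v) z≢w (T-∧ {B x z} .from (xz , yz)) (T-∧ {B x w} .from (xw , yw))) (c4 x y x≢y)

module _ {n m} (A : BipAdj n m) where

  short-walk-in-V₂ : ∀ {k v w} → k ≤ 3 → Walk A k (inj₂ v) (inj₂ w) → v ≡ w ⊎ ∃[ x ] (T (A x v) × T (A x w))
  short-walk-in-V₂ {0} _ refl                                             = inj₁ refl
  short-walk-in-V₂ {1} _ (inj₁ _ , _ , ())
  short-walk-in-V₂ {1} _ (inj₂ _ , () , _)
  short-walk-in-V₂ {2} _ (inj₁ x , xv , inj₂ _ , xw , refl)              = inj₂ (x , xv , xw)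
  short-walk-in-V₂ {2} _ (inj₁ _ , _ , inj₁ _ , () , _)
  short-walk-in-V₂ {2} _ (inj₂ _ , () , _)
  short-walk-in-V₂ {3} _ (inj₁ _ , _ , inj₂ _ , _ , inj₁ _ , _ , ())
  short-walk-in-V₂ {3} _ (inj₁ _ , _ , inj₂ _ , _ , inj₂ _ , () , _)
  short-walk-in-V₂ {3} _ (inj₁ _ , _ , inj₁ _ , () , _)
  short-walk-in-V₂ {3} _ (inj₂ _ , () , _)
  short-walk-in-V₂ {suc (suc (suc (suc _)))} (s≤s (s≤s (s≤s ()))) _

  diameter-3⇒HasCommonNeighbours : Diameter A 3 → HasCommonNeighbours (A ᵀ)
  diameter-3⇒HasCommonNeighbours (close , _) v w v≢w with close (inj₂ v) (inj₂ w)
  ... | k , k≤3 , walk with short-walk-in-V₂ k≤3 walk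
  ...   | inj₁ v≡w            = ⊥-elim (v≢w v≡w)
  ...   | inj₂ (x , xv , xw) = T⇒1≤count (λ x → A x v ∧ A x w) (T-∧ {A x v} .from (xv , xw))

m+n≤m*n : ∀ {m n} → 2 ≤ m → 2 ≤ n → m + n ≤ m * n
m+n≤m*n {suc (suc a)} {suc (suc b)} (s≤s (s≤s z≤n)) (s≤s (s≤s z≤n)) = ≤-trans (m≤m+n _ (a + b + a * b)) (≤-reflexive (identity a b))
  where
  open +-*-Solver
  identity : ∀ a b → (2 + a) + (2 + b) + (a + b + a * b) ≡ (2 + a) * (2 + b)
  identity = solve 2 (λ a b → (con 2 :+ a) :+ (con 2 :+ b) :+ (a :+ b :+ a :* b) := (con 2 :+ a) :* (con 2 :+ b)) refl

⌈suc/⌉≡suc[/] : ∀ k ρ .{{_ : NonZero ρ}} → ⌈ suc k / ρ ⌉ ≡ suc (k / ρ)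
⌈suc/⌉≡suc[/] k ρ@(suc ρ-1) = begin
  (suc k + ρ-1) / ρ ≡⟨ cong (_/ ρ) (+-suc k ρ-1) ⟨
  (k + ρ) / ρ       ≡⟨ +-distrib-/-∣ʳ k ∣-refl ⟩
  k / ρ + ρ / ρ     ≡⟨ cong (k / ρ +_) (n/n≡1 ρ) ⟩
  k / ρ + 1         ≡⟨ +-comm (k / ρ) 1 ⟩
  suc (k / ρ)       ∎
  where open ≡-Reasoning

moore-bound-not-attained : ∀ {s ρ n₁ n₂} → 2 ≤ s → 2 ≤ ρ → suc n₂ ≡ ρ * suc n₁
  → s + n₂ ≤ s * (ρ * s) → (s + n₂ ≡ s * (ρ * s) → ρ * s * s ≤ ρ * s + n₁)
  → s + n₂ < s * (ρ * s)
moore-bound-not-attained {s} {ρ} {n₁} {n₂} s≥2 ρ≥2 N₂≡ρN₁ moore tight⇒ with m≤n⇒m<n∨m≡n moore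
... | inj₁ moore-strict = moore-strict
... | inj₂ attained = ⊥-elim (<-irrefl refl (begin-strict
  ρ * s * s         ≤⟨ tight⇒ attained ⟩
  ρ * s + n₁        <⟨ +-monoʳ-< (ρ * s) n₁<s*s ⟩
  ρ * s + s * s     ≡⟨ *-distribʳ-+ s ρ s ⟨
  (ρ + s) * s       ≤⟨ *-monoˡ-≤ s (m+n≤m*n ρ≥2 s≥2) ⟩
  ρ * s * s         ∎))
  where
  open ≤-Reasoning
  ρ*suc-n₁≤ρ*[s*s] : ρ * suc n₁ ≤ ρ * (s * s)
  ρ*suc-n₁≤ρ*[s*s] = begin
    ρ * suc n₁    ≡⟨ N₂≡ρN₁ ⟨
    suc n₂        ≤⟨ +-monoˡ-≤ n₂ (≤-trans (s≤s z≤n) s≥2) ⟩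
    s + n₂        ≡⟨ attained ⟩
    s * (ρ * s)   ≡⟨ *-comm s (ρ * s) ⟩
    ρ * s * s     ≡⟨ *-assoc ρ s s ⟩
    ρ * (s * s)   ∎
  n₁<s*s : n₁ < s * s
  n₁<s*s = *-cancelˡ-≤ ρ {{nz ρ≥2}} ρ*suc-n₁≤ρ*[s*s]

N+⌈s/ρ⌉≤s*s : ∀ k ρ N .{{_ : NonZero ρ}} → k + ρ * N < suc k * (ρ * suc k) → N + ⌈ suc k / ρ ⌉ ≤ suc k * suc k
N+⌈s/ρ⌉≤s*s k ρ N k+ρN<s*ρs = begin
  N + ⌈ suc k / ρ ⌉ ≡⟨ cong (N +_) (⌈suc/⌉≡suc[/] k ρ) ⟩
  N + suc (k / ρ)   ≡⟨ +-suc N (k / ρ) ⟩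
  suc (N + k / ρ)   ≤⟨ *-cancelˡ-< ρ _ _ ρ[N+k/ρ]<ρ[s*s] ⟩
  s * s             ∎
  where
  open ≤-Reasoning
  s = suc k
  ρ[N+k/ρ]<ρ[s*s] : ρ * (N + k / ρ) < ρ * (s * s)
  ρ[N+k/ρ]<ρ[s*s] = begin-strict
    ρ * (N + k / ρ)       ≡⟨ *-distribˡ-+ ρ N (k / ρ) ⟩
    ρ * N + ρ * (k / ρ)   ≤⟨ +-monoʳ-≤ (ρ * N) (≤-trans (≤-reflexive (*-comm ρ (k / ρ))) (m/n*n≤m k ρ)) ⟩
    ρ * N + k             ≡⟨ +-comm (ρ * N) k ⟩
    k + ρ * N             <⟨ k+ρN<s*ρs ⟩
    s * (ρ * s)           ≡⟨ *-comm s (ρ * s) ⟩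
    ρ * s * s             ≡⟨ *-assoc ρ s s ⟩
    ρ * (s * s)           ∎

handshake-ratio : ∀ {n m} (B : BipAdj n m) ρ {s} .{{_ : NonZero s}} → Biregular B (ρ * s) s → m ≡ ρ * n
handshake-ratio {n} {m} B ρ {s} reg = *-cancelʳ-≡ m (ρ * n) s (begin
  m * s         ≡⟨ handshake B reg ⟨
  n * (ρ * s)   ≡⟨ *-assoc n ρ s ⟨
  n * ρ * s     ≡⟨ cong (_* s) (*-comm n ρ) ⟩
  ρ * n * s     ∎)
  where open ≡-Reasoning

left-order-bound : ∀ {N₁ N₂} (A : BipAdj N₁ N₂) {s ρ} → 2 ≤ s → 2 ≤ ρ → Biregular A (ρ * s) s → Diameter A 3
  → N₁ + ⌈ s / ρ ⌉ ≤ s * s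
left-order-bound {zero} A {suc k} {ρ} _ ρ≥2 _ _ = begin
  ⌈ suc k / ρ ⌉   ≡⟨ ⌈suc/⌉≡suc[/] k ρ ⟩
  suc (k / ρ)     ≤⟨ s≤s (m/n≤m k ρ) ⟩
  suc k           ≤⟨ m≤m*n (suc k) (suc k) ⟩
  suc k * suc k   ∎
  where
  open ≤-Reasoning
  instance
    ρ≢0 : NonZero ρ
    ρ≢0 = nz ρ≥2
-- With V₂ empty, deg₁ A zero reduces to 0.
left-order-bound {suc _} {zero} A (s≤s _) (s≤s (s≤s _)) (deg₁≡ρs , _) _ = ⊥-elim (0≢1+n (deg₁≡ρs zero))
left-order-bound {suc n₁} {suc n₂} A {s@(suc k)} {ρ} s≥2 ρ≥2 reg diam =
  N+⌈s/ρ⌉≤s*s k ρ (suc n₁) (subst (_< s * (ρ * s)) s+n₂≡k+ρN₁ (moore-bound-not-attained s≥2 ρ≥2 N₂≡ρN₁ moore tight⇒))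
  where
  instance
    ρ≢0 : NonZero ρ
    ρ≢0 = nz ρ≥2
  N₂≡ρN₁ : suc n₂ ≡ ρ * suc n₁
  N₂≡ρN₁ = handshake-ratio A ρ reg
  s+n₂≡k+ρN₁ : s + n₂ ≡ k + ρ * suc n₁
  s+n₂≡k+ρN₁ = trans (sym (+-suc k n₂)) (cong (k +_) N₂≡ρN₁)
  common : HasCommonNeighbours (A ᵀ)
  common = diameter-3⇒HasCommonNeighbours A diam
  moore : s + n₂ ≤ s * (ρ * s)
  moore = moore-bound (A ᵀ) (Biregular-ᵀ A reg) common
  tight⇒ : s + n₂ ≡ s * (ρ * s) → ρ * s * s ≤ ρ * s + n₁
  tight⇒ = C₄-free-bound A reg ∘ C₄-free-ᵀ (A ᵀ) ∘ moore-bound-tight⇒C₄-free (A ᵀ) (Biregular-ᵀ A reg) common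

corollary2p3 : (s ρ : ℕ) → 2 ≤ s → (ρ≥2 : 2 ≤ ρ) → (N₁ N₂ : ℕ) → (A : BipAdj N₁ N₂)
    → Biregular A (ρ * s) s → Diameter A 3
    → (ρ ∣ (s ∸ 1) → N₁ ≤ (s * s ∸ 1) ∸ ((s ∸ 1) / ρ) {{Defs.nz ρ≥2}} × N₂ ≤ ρ * (s * s ∸ 1) ∸ (s ∸ 1))
    × (¬ (ρ ∣ (s ∸ 1)) → N₁ ≤ s * s ∸ ⌈ s / ρ ⌉ × N₂ ≤ ρ * (s * s ∸ ⌈ s / ρ ⌉))
corollary2p3 s@(suc k) ρ s≥2 ρ≥2 N₁ N₂ A reg diam = part-i , λ _ → N₁≤ , N₂≤ρ* N₁≤
  where
  instance
    ρ≢0 : NonZero ρ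
    ρ≢0 = nz ρ≥2
  N₁≤ : N₁ ≤ s * s ∸ ⌈ s / ρ ⌉
  N₁≤ = m+n≤o⇒m≤o∸n N₁ (left-order-bound A s≥2 ρ≥2 reg diam)
  N₂≤ρ* : ∀ {X} → N₁ ≤ X → N₂ ≤ ρ * X
  N₂≤ρ* N₁≤X = subst (_≤ _) (sym (handshake-ratio A ρ reg)) (*-monoʳ-≤ ρ N₁≤X)
  part-i : ρ ∣ k → N₁ ≤ (s * s ∸ 1) ∸ k / ρ × N₂ ≤ ρ * (s * s ∸ 1) ∸ k
  part-i ρ∣k = subst (N₁ ≤_) N₁-form N₁≤ , subst (N₂ ≤_) N₂-form (N₂≤ρ* N₁≤)
    where
    open ≡-Reasoning
    N₁-form : s * s ∸ ⌈ s / ρ ⌉ ≡ (s * s ∸ 1) ∸ k / ρ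
    N₁-form = trans (cong (s * s ∸_) (⌈suc/⌉≡suc[/] k ρ)) (sym (∸-+-assoc (s * s) 1 (k / ρ)))
    N₂-form : ρ * (s * s ∸ ⌈ s / ρ ⌉) ≡ ρ * (s * s ∸ 1) ∸ k
    N₂-form = begin
      ρ * (s * s ∸ ⌈ s / ρ ⌉)         ≡⟨ cong (ρ *_) N₁-form ⟩
      ρ * ((s * s ∸ 1) ∸ k / ρ)       ≡⟨ *-distribˡ-∸ ρ (s * s ∸ 1) (k / ρ) ⟩
      ρ * (s * s ∸ 1) ∸ ρ * (k / ρ)   ≡⟨ cong (ρ * (s * s ∸ 1) ∸_) (m*[n/m]≡n ρ∣k) ⟩
      ρ * (s * s ∸ 1) ∸ k             ∎
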